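{- Let $w$ be a pp-irreducible string and let $c,d$ be positions of $w$ with $c<d\le\mathscr{F}_w(c)$. Then $\mathscr{F}_w(c)\ge\mathscr{F}_w(d)$.
   Context: Strings over $\Sigma$, positions $1,\dots,|w|$, $w[i:j]=w[i]\cdots w[j]$, $\overline{x}$ the reverse. Palindromes are even palindromes $x\overline{x}$; for a position $c$, $\rho_w(c)$ is the largest $r\ge 0$ with $c-r\ge0$, $c+r\le|w|$ and $w[c-r+1:c+r]$ a palindrome. A Z-shape is $x\overline{x}x$, $x$ nonempty; a string is irreducible if no Z-shape occurs in it as a substring. $w$ is pp-irreducible if $w[1:|w|-1]$ is irreducible. For a pp-irreducible $w$ and distinct positions $c,d$, write $c\sqsubset_w d$ if $c\le d-\rho_w(d)\le d\le c+\rho_w(c)\le d+\rho_w(d)$. A palindrome chain from $c_0$ in $w$ is a sequence $(c_0,\dots,c_k)$, $k\ge0$, with $c_{i-1}\sqsubset_w c_i$ for $i\in[1:k]$; its frontier is $c_k+\rho_w(c_k)$. $\mathscr{F}_w(c)$ is the maximum frontier over all palindrome chains from $c$. -}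

module Defs where

open import Data.Nat using (ℕ; _+_; _∸_; _≤_; _<_)
open import Data.List using (List; []; _++_; reverse; take; drop; length)
open import Data.Product using (Σ; ∃; _×_)
open import Relation.Binary.PropositionalEquality using (_≡_; _≢_)
open import Relation.Nullary using (¬_)

-- Strings over an alphabet A are lists; positions are 1 … |w|.
-- w[i:j] = take (j ∸ i + 1) (drop (i ∸ 1) w)  (1-based, inclusive).

IsPal : {A : Set} → List A → Set
IsPal {A} s = Σ (List A) λ x → s ≡ x ++ reverse x

HasZShape : {A : Set} → List A → Set
HasZShape {A} w = Σ (List A) λ x → Σ (List A) λ u → Σ (List A) λ v →
  (x ≢ []) × (w ≡ u ++ ((x ++ reverse x ++ x) ++ v))

Irreducible : {A : Set} → List A → Set
Irreducible w = ¬ HasZShape w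

PPIrreducible : {A : Set} → List A → Set
PPIrreducible w = Irreducible (take (length w ∸ 1) w)

-- r is an admissible radius at c: c - r ≥ 0, c + r ≤ |w|,
-- w[c-r+1 : c+r] (i.e. drop (c-r), take 2r) is a palindrome.
Radius : {A : Set} → List A → ℕ → ℕ → Set
Radius w c r = (r ≤ c) × (c + r ≤ length w) × IsPal (take (r + r) (drop (c ∸ r) w))

IsRho : {A : Set} → List A → ℕ → ℕ → Set
IsRho w c r = Radius w c r × (∀ r' → Radius w c r' → r' ≤ r)

Pos : {A : Set} → List A → ℕ → Set
Pos w c = (1 ≤ c) × (c ≤ length w)

Sq : {A : Set} → List A → ℕ → ℕ → Set
Sq w c d = Pos w c × Pos w d × (c ≢ d) ×
  Σ ℕ λ rc → Σ ℕ λ rd → IsRho w c rc × IsRho w d rd ×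
    (c ≤ d ∸ rd) × (d ∸ rd ≤ d) × (d ≤ c + rc) × (c + rc ≤ d + rd)

-- Chain w c f : there is a palindrome chain (c = c₀, …, c_k) from c in w
-- (k ≥ 0, c_{i-1} ⊏ c_i) whose frontier c_k + ρ(c_k) equals f.
data Chain {A : Set} (w : List A) : ℕ → ℕ → Set where
  stop : ∀ {c r} → Pos w c → IsRho w c r → Chain w c (c + r)
  step : ∀ {c d f} → Sq w c d → Chain w d f → Chain w c f

IsMaxFrontier : {A : Set} → List A → ℕ → ℕ → Set
IsMaxFrontier w c f = Chain w c f × (∀ g → Chain w c g → g ≤ f)

-- The combinatorial heart is a "no overlap" property (reach-back): if
-- c < d ≤ c + ρ(c), then the palindrome at d does not reach left of c, since
-- otherwise, with L = d - c, the palindromes at c and d contain two adjacent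
-- mirror images of width L, which spell a Z-shape y ȳ y ending before the last
-- letter of w.
--
-- Consequently c ⊏ d holds as soon as c < d ≤ c + ρ(c) ≤ d + ρ(d) (⊏-intro).
-- From this, any chain starting strictly inside the palindrome at c is
-- dominated by a chain from c (absorb), and more generally any chain from a
-- position d ≤ f, for f the frontier of a chain from c, is dominated by a chain
-- from c (extend).  Applying extend to maximal chains gives the corollary.
module Submission where

open import Data.Nat using (ℕ; zero; suc; _+_; _∸_; _≤_; _<_; _⊓_)
open import Data.Nat.Properties
open import Data.List using (List; []; _∷_; _++_; reverse; take; drop; length)
open import Data.List.Properties
  using (length-take; length-drop; length-++; length-reverse; take-[]; take-take; take-drop;
         drop-drop; take++drop≡id; ++-assoc; reverse-++; reverse-involutive; ∷-injective)
open import Data.Product using (Σ; _×_; _,_; proj₁; proj₂)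
open import Data.Empty using (⊥-elim)
open import Relation.Nullary using (yes; no)
open import Relation.Binary.Definitions using (tri<; tri≈; tri>)
open import Relation.Binary.PropositionalEquality
open import Defs

-- seg i n w is the factor w[i+1 : i+n] of w: the n letters following position i.
seg : {A : Set} → ℕ → ℕ → List A → List A
seg i n w = take n (drop i w)

module _ {A : Set} where

  take-+ : ∀ m n (xs : List A) → take (m + n) xs ≡ take m xs ++ take n (drop m xs)
  take-+ zero    n xs       = refl
  take-+ (suc m) n []       = sym (take-[] n)
  take-+ (suc m) n (x ∷ xs) = cong (x ∷_) (take-+ m n xs)

  seg-+ : ∀ i m n (w : List A) → seg i (m + n) w ≡ seg i m w ++ seg (i + m) n w
  seg-+ i m n w = trans (take-+ m n (drop i w)) (cong (λ v → seg i m w ++ take n v) (drop-drop i m w))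

  length-seg : ∀ i n (w : List A) → i + n ≤ length w → length (seg i n w) ≡ n
  length-seg i n w bound = trans (length-take n (drop i w))
    (m≤n⇒m⊓n≡m (subst (n ≤_) (sym (length-drop i w))
      (m+n≤o⇒m≤o∸n n (subst (_≤ length w) (+-comm i n) bound))))

  seg-take : ∀ i m p (w : List A) → i + m ≤ p → seg i m (take p w) ≡ seg i m w
  seg-take i m p w bound = begin
      take m (drop i (take p w))        ≡⟨ cong (λ q → take m (drop i (take q w))) (sym (m+[n∸m]≡n i≤p)) ⟩
      take m (drop i (take (i + k) w))  ≡⟨ cong (take m) (sym (take-drop k i w)) ⟩
      take m (take k (drop i w))        ≡⟨ take-take m k (drop i w) ⟩
      take (m ⊓ k) (drop i w)           ≡⟨ cong (λ q → take q (drop i w)) (m≤n⇒m⊓n≡m m≤k) ⟩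
      seg i m w                         ∎
    where
    open ≡-Reasoning
    k = p ∸ i
    i≤p : i ≤ p
    i≤p = ≤-trans (m≤m+n i m) bound
    m≤k : m ≤ k
    m≤k = m+n≤o⇒m≤o∸n m (subst (_≤ p) (+-comm i m) bound)

  seg-occurs : ∀ i m (w : List A) → w ≡ take i w ++ (seg i m w ++ drop m (drop i w))
  seg-occurs i m w =
    sym (trans (cong (take i w ++_) (take++drop≡id m (drop i w))) (take++drop≡id i w))

  ++-split : ∀ (xs xs' : List A) {ys ys'} → length xs ≡ length xs' →
             xs ++ ys ≡ xs' ++ ys' → xs ≡ xs' × ys ≡ ys'
  ++-split []       []         _    eq = refl , eq
  ++-split (x ∷ xs) (x' ∷ xs') lens eq with ∷-injective eq
  ... | refl , eq' with ++-split xs xs' (suc-injective lens) eq'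
  ...   | refl , eq'' = refl , eq''

-- Mirror w c L: the L letters after position c are the reversal of the L
-- letters before it, i.e. w[c-L+1 : c+L] is an even palindrome centred at c.
Mirror : {A : Set} → List A → ℕ → ℕ → Set
Mirror w c L = seg c L w ≡ reverse (seg (c ∸ L) L w)

double-injective : ∀ m n → m + m ≡ n + n → m ≡ n
double-injective zero    zero    _  = refl
double-injective (suc m) (suc n) eq = cong suc (double-injective m n
  (suc-injective (trans (sym (+-suc m m)) (trans (suc-injective eq) (+-suc n n)))))

module _ {A : Set} {w : List A} where

  mirror-full : ∀ {c r} → Radius w c r → Mirror w c r
  mirror-full {c} {r} (r≤c , c+r≤n , x , pal) =
    trans (proj₂ halves) (cong reverse (sym (proj₁ halves)))
    where
    e = c ∸ r
    e+r≡c : e + r ≡ c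
    e+r≡c = m∸n+n≡m r≤c
    length-x : length x ≡ r
    length-x = double-injective (length x) r (begin
      length x + length x                  ≡⟨ cong (length x +_) (sym (length-reverse x)) ⟩
      length x + length (reverse x)        ≡⟨ sym (length-++ x) ⟩
      length (x ++ reverse x)              ≡⟨ cong length (sym pal) ⟩
      length (seg e (r + r) w)             ≡⟨ length-seg e (r + r) w
                                                (subst (_≤ length w) (trans (cong (_+ r) (sym e+r≡c)) (+-assoc e r r)) c+r≤n) ⟩
      r + r                                ∎)
      where open ≡-Reasoning
    length-left : length (seg e r w) ≡ r
    length-left = length-seg e r w (subst (_≤ length w) (sym e+r≡c) (≤-trans (m≤m+n c r) c+r≤n))
    halves : seg e r w ≡ x × seg c r w ≡ reverse x
    halves = ++-split (seg e r w) x (trans length-left (sym length-x))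
      (trans (cong (λ i → seg e r w ++ seg i r w) (sym e+r≡c)) (trans (sym (seg-+ e r r w)) pal))

  mirror : ∀ {c r L} → Radius w c r → L ≤ r → Mirror w c L
  mirror {c} {r} {L} radius@(r≤c , c+r≤n , _) L≤r =
    subst (λ i → seg c L w ≡ reverse (seg i L w)) e+k≡c∸L (proj₁ (++-split _ _ lengths both))
    where
    open ≡-Reasoning
    e = c ∸ r
    k = r ∸ L
    e+k≡c∸L : e + k ≡ c ∸ L
    e+k≡c∸L = sym (trans (cong (_∸ L) (sym (m∸n+n≡m r≤c))) (+-∸-assoc e L≤r))
    both : seg c L w ++ seg (c + L) k w ≡ reverse (seg (e + k) L w) ++ reverse (seg e k w)
    both = begin
      seg c L w ++ seg (c + L) k w    ≡⟨ sym (seg-+ c L k w) ⟩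
      seg c (L + k) w                 ≡⟨ cong (λ n → seg c n w) (m+[n∸m]≡n L≤r) ⟩
      seg c r w                       ≡⟨ mirror-full radius ⟩
      reverse (seg e r w)             ≡⟨ cong (λ n → reverse (seg e n w)) (sym (m∸n+n≡m L≤r)) ⟩
      reverse (seg e (k + L) w)       ≡⟨ cong reverse (seg-+ e k L w) ⟩
      reverse (seg e k w ++ seg (e + k) L w)            ≡⟨ reverse-++ (seg e k w) _ ⟩
      reverse (seg (e + k) L w) ++ reverse (seg e k w)  ∎
    c+L≤n : c + L ≤ length w
    c+L≤n = ≤-trans (+-monoʳ-≤ c L≤r) c+r≤n
    lengths : length (seg c L w) ≡ length (reverse (seg (e + k) L w))
    lengths = begin
      length (seg c L w)                   ≡⟨ length-seg c L w c+L≤n ⟩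
      L                                    ≡⟨ sym (length-seg (e + k) L w
                                                (subst (_≤ length w) (sym e+k+L≡c) (≤-trans (m≤m+n c L) c+L≤n))) ⟩
      length (seg (e + k) L w)             ≡⟨ sym (length-reverse (seg (e + k) L w)) ⟩
      length (reverse (seg (e + k) L w))   ∎
      where
      e+k+L≡c : e + k + L ≡ c
      e+k+L≡c = trans (cong (_+ L) e+k≡c∸L) (m∸n+n≡m (≤-trans L≤r r≤c))

module _ {A : Set} where

  mirror-take : ∀ {w : List A} {c L} p → Mirror w c L → c + L ≤ p → Mirror (take p w) c L
  mirror-take {w} {c} {L} p m bound = begin
      seg c L (take p w)                    ≡⟨ seg-take c L p w bound ⟩
      seg c L w                             ≡⟨ m ⟩
      reverse (seg (c ∸ L) L w)             ≡⟨ cong reverse (sym (seg-take (c ∸ L) L p w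
                                                 (≤-trans (+-monoˡ-≤ L (m∸n≤m c L)) bound))) ⟩
      reverse (seg (c ∸ L) L (take p w))    ∎
    where open ≡-Reasoning

  -- Two mirrors of the same positive width L, at c and at c + L, produce the
  -- Z-shape y ȳ y with y = w[c-L+1 : c].
  zshape : ∀ {w : List A} {c L} → 0 < L → L ≤ c → c ≤ length w →
           Mirror w c L → Mirror w (c + L) L → HasZShape w
  zshape {w} {c} {L} 0<L L≤c c≤n first second =
    y , take a w , drop (L + L + L) (drop a w) , y≢[] ,
    trans (seg-occurs a (L + L + L) w) (cong (λ s → take a w ++ (s ++ drop (L + L + L) (drop a w))) block)
    where
    open ≡-Reasoning
    a = c ∸ L
    y = seg a L w
    a+L≡c : a + L ≡ c
    a+L≡c = m∸n+n≡m L≤c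
    third : seg (c + L) L w ≡ y
    third = begin
      seg (c + L) L w                 ≡⟨ second ⟩
      reverse (seg (c + L ∸ L) L w)   ≡⟨ cong (λ i → reverse (seg i L w)) (m+n∸n≡m c L) ⟩
      reverse (seg c L w)             ≡⟨ cong reverse first ⟩
      reverse (reverse y)             ≡⟨ reverse-involutive y ⟩
      y                               ∎
    block : seg a (L + L + L) w ≡ y ++ reverse y ++ y
    block = begin
      seg a (L + L + L) w                              ≡⟨ seg-+ a (L + L) L w ⟩
      seg a (L + L) w ++ seg (a + (L + L)) L w         ≡⟨ cong (_++ seg (a + (L + L)) L w) (seg-+ a L L w) ⟩
      (y ++ seg (a + L) L w) ++ seg (a + (L + L)) L w  ≡⟨ cong₂ (λ i j → (y ++ seg i L w) ++ seg j L w)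
                                                            a+L≡c (trans (sym (+-assoc a L L)) (cong (_+ L) a+L≡c)) ⟩
      (y ++ seg c L w) ++ seg (c + L) L w              ≡⟨ cong₂ (λ u v → (y ++ u) ++ v) first third ⟩
      (y ++ reverse y) ++ y                            ≡⟨ ++-assoc y (reverse y) y ⟩
      y ++ reverse y ++ y                              ∎
    y≢[] : y ≢ []
    y≢[] y≡[] = <⇒≢ 0<L (trans (sym (cong length y≡[]))
                          (length-seg a L w (subst (_≤ length w) (sym a+L≡c) c≤n)))

  reach-back : ∀ {w : List A} {c d rc rd} → PPIrreducible w → Radius w c rc → Radius w d rd →
               c < d → d ≤ c + rc → c ≤ d ∸ rd
  reach-back {w} {c} {d} {rc} {rd} irreducible radius-c radius-d c<d d≤c+rc with c ≤? d ∸ rd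
  ... | yes c≤d∸rd = c≤d∸rd
  ... | no  c≰d∸rd = ⊥-elim (irreducible (zshape {w = t} 0<L L≤c c≤|t|
          (mirror-take p (mirror radius-c L≤rc) c+L≤p)
          (subst (λ i → Mirror t i L) (sym c+L≡d) (mirror-take p (mirror radius-d (<⇒≤ L<rd)) d+L≤p))))
    where
    n = length w
    p = n ∸ 1
    t = take p w
    L = d ∸ c
    0<L : 0 < L
    0<L = m<n⇒0<n∸m c<d
    c+L≡d : c + L ≡ d
    c+L≡d = m+[n∸m]≡n (<⇒≤ c<d)
    L≤rc : L ≤ rc
    L≤rc = m≤n+o⇒m∸n≤o d c d≤c+rc
    L≤c : L ≤ c
    L≤c = ≤-trans L≤rc (proj₁ radius-c)
    -- otherwise the palindrome at d would reach back to d ∸ L = c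
    L<rd : L < rd
    L<rd = ≰⇒> λ rd≤L → c≰d∸rd (subst (_≤ d ∸ rd) (trans (cong (_∸ L) (sym c+L≡d)) (m+n∸n≡m c L))
                                       (∸-monoʳ-≤ d rd≤L))
    d+L≤p : d + L ≤ p
    d+L≤p = subst (d + L ≤_) (pred[m∸n]≡m∸[1+n] n 0)
              (<⇒≤pred (subst (_≤ n) (+-suc d L) (≤-trans (+-monoʳ-≤ d L<rd) (proj₁ (proj₂ radius-d)))))
    c+L≤p : c + L ≤ p
    c+L≤p = ≤-trans (≤-reflexive c+L≡d) (≤-trans (m≤m+n d L) d+L≤p)
    c≤|t| : c ≤ length t
    c≤|t| = subst (c ≤_) (sym (trans (length-take p w) (m≤n⇒m⊓n≡m (m∸n≤m n 1))))
              (≤-trans (m≤m+n c L) c+L≤p)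

Reaches : {A : Set} → List A → ℕ → ℕ → Set
Reaches w c g = Σ ℕ λ f → Chain w c f × g ≤ f

module _ {A : Set} {w : List A} (irreducible : PPIrreducible w) where

  -- In a pp-irreducible string, c ⊏ d only requires c < d ≤ c + ρ(c) ≤ d + ρ(d):
  -- the remaining condition c ≤ d - ρ(d) is forced by reach-back.
  ⊏-intro : ∀ {c d rc rd} → Pos w c → Pos w d → IsRho w c rc → IsRho w d rd →
            c < d → d ≤ c + rc → c + rc ≤ d + rd → Sq w c d
  ⊏-intro {d = d} {rd = rd} pos-c pos-d rho-c rho-d c<d d≤c+rc c+rc≤d+rd =
    pos-c , pos-d , <⇒≢ c<d , _ , _ , rho-c , rho-d ,
    reach-back irreducible (proj₁ rho-c) (proj₁ rho-d) c<d d≤c+rc , m∸n≤m d rd , d≤c+rc , c+rc≤d+rd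

  -- A chain starting at d, strictly inside the palindrome at c, is dominated by
  -- a chain from c: either the palindrome at c already reaches further, or the
  -- first chain element that reaches beyond c + ρ(c) can be linked to c.
  absorb : ∀ {c d rc g} → Pos w c → IsRho w c rc → c < d → d ≤ c + rc →
           Chain w d g → Reaches w c g
  absorb {c} {d} {rc} pos-c rho-c c<d d≤c+rc (stop {r = rd} pos-d rho-d) with c + rc ≤? d + rd
  ... | yes c+rc≤d+rd = _ , step (⊏-intro pos-c pos-d rho-c rho-d c<d d≤c+rc c+rc≤d+rd) (stop pos-d rho-d) , ≤-refl
  ... | no  c+rc≰d+rd = _ , stop pos-c rho-c , <⇒≤ (≰⇒> c+rc≰d+rd)
  absorb {c} {d} {rc} pos-c rho-c c<d d≤c+rc
         (step d⊏e@(pos-d , _ , _ , rd , _ , rho-d , _ , d≤e∸re , e∸re≤e , e≤d+rd , _) chain)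
    with c + rc ≤? d + rd
  ... | yes c+rc≤d+rd = _ , step (⊏-intro pos-c pos-d rho-c rho-d c<d d≤c+rc c+rc≤d+rd) (step d⊏e chain) , ≤-refl
  ... | no  c+rc≰d+rd = absorb pos-c rho-c (<-≤-trans c<d (≤-trans d≤e∸re e∸re≤e))
                               (≤-trans e≤d+rd (<⇒≤ (≰⇒> c+rc≰d+rd))) chain

  -- Walk along the chain from c to
  -- the element whose palindrome contains d, and absorb the chain from d there.
  extend : ∀ {c d f g} → Chain w c f → c < d → d ≤ f → Chain w d g → Reaches w c g
  extend (stop pos-c rho-c) c<d d≤f chain = absorb pos-c rho-c c<d d≤f chain
  extend {d = d} (step {d = e} c⊏e@(pos-c , _ , _ , _ , _ , rho-c , _ , _ , _ , e≤c+rc , _) rest) c<d d≤f chain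
    with <-cmp d e
  ... | tri< d<e _ _ = absorb pos-c rho-c c<d (≤-trans (<⇒≤ d<e) e≤c+rc) chain
  ... | tri≈ _ refl _ = _ , step c⊏e chain , ≤-refl
  ... | tri> _ _ e<d with extend rest e<d d≤f chain
  ...   | f' , chain' , g≤f' = f' , step c⊏e chain' , g≤f'

corollary3 : {A : Set} (w : List A) → PPIrreducible w →
    (c d Fc Fd : ℕ) → Pos w c → Pos w d →
    IsMaxFrontier w c Fc → IsMaxFrontier w d Fd →
    c < d → d ≤ Fc → Fd ≤ Fc
corollary3 w irreducible c d Fc Fd _ _ (chain-c , maximal-c) (chain-d , _) c<d d≤Fc
  with extend irreducible chain-c c<d d≤Fc chain-d
... | f , chain , Fd≤f = ≤-trans Fd≤f (maximal-c f chain)
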